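{- Let $n\ge 1$, let $B=(b_{ij})$ be a real $n\times n$ matrix with $b_{ij}\ge 0$ for all $i,j$ and $b_{ii}=0$, let $c\in\mathbb{R}^n$ and $X\subseteq\{0,1\}^n$, and let (P) be the problem: minimize $x^TBx+c^Tx$ over $x\in X$. Let $\overline{X}$ satisfy $X\subseteq\overline{X}\subseteq[0,1]^n$, and let $u_i=\max\{\sum_{j\neq i}b_{ij}x_j : x\in\overline{X}\}$, $i=1,\dots,n$. For $\lambda\in\{0,1\}^n$ put $\alpha_i^{(\lambda)}=\sum_{j\neq i}\lambda_jb_{ji}+\lambda_iu_i$ and $\beta^{(\lambda)}=\sum_{i=1}^n\lambda_iu_i$. For a positive integer $s$ and vectors $\lambda^{(1)},\dots,\lambda^{(s)}\in\{0,1\}^n$, let (DL$_1^s$) denote the restricted master problem: minimize $z+\sum_{i=1}^nc_ix_i$ over $(z,x)\in\mathbb{R}\times X$ subject to $z\ge\sum_{i=1}^n\alpha_i^{(\lambda^{(t)})}x_i-\beta^{(\lambda^{(t)})}$ for $t=1,\dots,s$. Let $\lambda^{(1)},\lambda^{(2)},\dots\in\{0,1\}^n$, let $r\ge 1$, suppose $\widetilde{x}$ is an optimal solution (i.e. $(\widetilde z,\widetilde{x})$ is optimal for some $\widetilde z$) of (DL$_1^r$), and suppose $\lambda^{(r+1)}=\widetilde{x}$. Then for any $s>r$, $\widetilde{x}$ cannot be an optimal solution of (DL$_1^s$) unless $\widetilde{x}$ is an optimal solution of (P).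
   Context: The restricted master problems use a subset of the cuts of the Balas–Mazzola linearization (DL$_1$) of (P), which has one cut for every $\lambda\in\{0,1\}^n$. $\overline{X}$ is a relaxation of $X$ assumed chosen so that the maxima defining $u_i$ are attained. -}

module Defs where

open import Level using (Level; _⊔_) renaming (suc to lsuc)
open import Data.Nat using (ℕ; zero; suc)
open import Data.Fin using (Fin; zero; suc; _≟_)
open import Data.Bool using (Bool; true; false; if_then_else_)
open import Data.Product using (Σ; ∃; _×_; _,_)
open import Relation.Nullary using (¬_; does)
open import Algebra.Bundles using (CommutativeRing)
open import Relation.Binary.Structures using (IsTotalOrder)

-- An ordered field (the paper works over ℝ, which is one).  The standard
-- library has no real numbers and no ordered-field bundle, so we state the
-- result for an arbitrary ordered field.
record OrderedField (c ℓ₁ ℓ₂ : Level) : Set (lsuc (c ⊔ ℓ₁ ⊔ ℓ₂)) where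
  field
    commutativeRing : CommutativeRing c ℓ₁
  open CommutativeRing commutativeRing public
  field
    _≤_          : Carrier → Carrier → Set ℓ₂
    isTotalOrder : IsTotalOrder _≈_ _≤_
    +-mono-≤     : ∀ {a b} (d : Carrier) → a ≤ b → (a + d) ≤ (b + d)
    *-nonneg     : ∀ {a b} → 0# ≤ a → 0# ≤ b → 0# ≤ (a * b)
    0≉1          : ¬ (0# ≈ 1#)
    inverse      : ∀ x → ¬ (x ≈ 0#) → ∃ λ y → (x * y) ≈ 1#

module _ {c ℓ₁ ℓ₂ : Level} (F : OrderedField c ℓ₁ ℓ₂) where
  open OrderedField F using (Carrier; _≈_; _≤_; _+_; _*_; _-_; 0#; 1#)

  sumF : (n : ℕ) → (Fin n → Carrier) → Carrier
  sumF zero    f = 0#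
  sumF (suc n) f = f zero + sumF n (λ i → f (suc i))

  sumExcept : (n : ℕ) → Fin n → (Fin n → Carrier) → Carrier
  sumExcept n i f = sumF n (λ j → if does (i ≟ j) then 0# else f j)

  emb : {n : ℕ} → (Fin n → Bool) → Fin n → Carrier
  emb x i = if x i then 1# else 0#

  objP : (n : ℕ) → (Fin n → Fin n → Carrier) → (Fin n → Carrier) →
         (Fin n → Bool) → Carrier
  objP n B cv x =
    sumF n (λ i → sumF n (λ j → emb x i * (B i j * emb x j)))
      + sumF n (λ i → cv i * emb x i)

  OptimalP : (n : ℕ) → (Fin n → Fin n → Carrier) → (Fin n → Carrier) →
             ((Fin n → Bool) → Set ℓ₂) → (Fin n → Bool) → Set ℓ₂
  OptimalP n B cv X x = X x × (∀ y → X y → objP n B cv x ≤ objP n B cv y)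

  IsMaxU : (n : ℕ) → (Fin n → Fin n → Carrier) → ((Fin n → Carrier) → Set ℓ₂) →
           (Fin n → Carrier) → Set (c ⊔ ℓ₁ ⊔ ℓ₂)
  IsMaxU n B X̄ u = ∀ i →
      (∀ x → X̄ x → sumExcept n i (λ j → B i j * x j) ≤ u i)
    × (∃ λ x → X̄ x × (sumExcept n i (λ j → B i j * x j) ≈ u i))

  alpha : (n : ℕ) → (Fin n → Fin n → Carrier) → (Fin n → Carrier) →
          (Fin n → Bool) → Fin n → Carrier
  alpha n B u lam i = sumExcept n i (λ j → emb lam j * B j i) + emb lam i * u i

  beta : (n : ℕ) → (Fin n → Carrier) → (Fin n → Bool) → Carrier
  beta n u lam = sumF n (λ i → emb lam i * u i)

  Cut : (n : ℕ) → (Fin n → Fin n → Carrier) → (Fin n → Carrier) →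
        (Fin n → Bool) → Carrier → (Fin n → Bool) → Set ℓ₂
  Cut n B u lam z x = (sumF n (λ i → alpha n B u lam i * emb x i) - beta n u lam) ≤ z

  -- (z, x) is feasible for (DL₁ˢ) built from cuts λ⁽¹⁾, …, λ⁽ˢ⁾
  -- (the cut sequence is indexed by ℕ, entries 1..s are used)
  FeasibleDL : (n : ℕ) → (Fin n → Fin n → Carrier) → (Fin n → Carrier) →
               ((Fin n → Bool) → Set ℓ₂) → (ℕ → Fin n → Bool) → ℕ →
               Carrier → (Fin n → Bool) → Set ℓ₂
  FeasibleDL n B u X lams s z x =
    X x × (∀ t → 1 Data.Nat.≤ t → t Data.Nat.≤ s → Cut n B u (lams t) z x)

  objDL : (n : ℕ) → (Fin n → Carrier) → Carrier → (Fin n → Bool) → Carrier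
  objDL n cv z x = z + sumF n (λ i → cv i * emb x i)

  OptimalDL : (n : ℕ) → (Fin n → Fin n → Carrier) → (Fin n → Carrier) →
              (Fin n → Carrier) → ((Fin n → Bool) → Set ℓ₂) →
              (ℕ → Fin n → Bool) → ℕ → Carrier → (Fin n → Bool) →
              Set (c ⊔ ℓ₂)
  OptimalDL n B cv u X lams s z x =
    FeasibleDL n B u X lams s z x ×
    (∀ z' x' → FeasibleDL n B u X lams s z' x' → objDL n cv z x ≤ objDL n cv z' x')

  OptimalSolDL : (n : ℕ) → (Fin n → Fin n → Carrier) → (Fin n → Carrier) →
                 (Fin n → Carrier) → ((Fin n → Bool) → Set ℓ₂) →
                 (ℕ → Fin n → Bool) → ℕ → (Fin n → Bool) → Set (c ⊔ ℓ₂)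
  OptimalSolDL n B cv u X lams s x = ∃ λ z → OptimalDL n B cv u X lams s z x

module Submission where

-- Write Q(x) = xᵀBx for the quadratic part of the objective of (P).  The proof
-- rests on two properties of the cut for λ ∈ {0,1}ⁿ, evaluated at a 0/1 point x:
--   * validity:  cut_λ(x) ≤ Q(x) whenever x ∈ X̄, so (Q(y), y) is feasible for
--     every restricted master problem when y ∈ X;
--   * exactness: cut_x(x) = Q(x), so once λ⁽ʳ⁺¹⁾ = x̃ is among the cuts,
--     every feasible (z, x̃) has Q(x̃) ≤ z.
-- If (z, x̃) is optimal for (DL₁ˢ) with s > r, then for every y ∈ X
--   Q(x̃) + cᵀx̃ ≤ z + cᵀx̃ ≤ Q(y) + cᵀy,
-- i.e. x̃ is optimal for (P).
-- Both properties are coordinatewise: with the row loads sⱼ(x) = ∑ᵢ bⱼᵢxᵢ,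
--   cut_λ(x) = ∑ⱼ λⱼ (sⱼ + uⱼxⱼ − uⱼ)   and   Q(x) = ∑ⱼ xⱼ sⱼ,
-- and 0 ≤ sⱼ ≤ uⱼ on X̄.

open import Defs
open import Level using (Level)
open import Data.Nat using (ℕ; zero; suc; _<_; s≤s; z≤n)
open import Data.Fin using (Fin; _≟_) renaming (zero to fzero; suc to fsuc)
open import Data.Bool using (Bool; true; false; if_then_else_)
open import Data.Product using (_×_; _,_; proj₁)
open import Relation.Nullary using (does; yes; no)
open import Relation.Binary.PropositionalEquality using (_≡_) renaming (refl to ≡-refl)
open import Relation.Binary.Structures using (IsTotalOrder)
import Relation.Binary.Reasoning.Setoid as SetoidReasoning
import Algebra.Properties.CommutativeSemigroup as CommutativeSemigroupProperties
import Algebra.Properties.AbelianGroup as AbelianGroupProperties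
import Algebra.Properties.Group as GroupProperties
import Algebra.Properties.Ring as RingProperties

module OrderedFieldFacts {c ℓ₁ ℓ₂ : Level} (F : OrderedField c ℓ₁ ℓ₂) where
  open OrderedField F renaming (Carrier to K)
  open IsTotalOrder isTotalOrder using (≲-respˡ-≈; ≲-respʳ-≈)
  open IsTotalOrder isTotalOrder public using ()
    renaming (trans to ≤-trans; reflexive to ≤-reflexive)
  open SetoidReasoning setoid
  open GroupProperties +-group using (//-rightDividesʳ)
  open AbelianGroupProperties +-abelianGroup using (⁻¹-∙-comm)
  open CommutativeSemigroupProperties +-commutativeSemigroup
    using () renaming (interchange to +-interchange)
  open RingProperties ring using (-‿distribʳ-*)

  ≤-resp-≈ : ∀ {a a′ b b′} → a ≈ a′ → b ≈ b′ → a′ ≤ b′ → a ≤ b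
  ≤-resp-≈ a≈a′ b≈b′ a′≤b′ = ≲-respˡ-≈ (sym a≈a′) (≲-respʳ-≈ (sym b≈b′) a′≤b′)

  +-mono₂-≤ : ∀ {a b d e} → a ≤ b → d ≤ e → (a + d) ≤ (b + e)
  +-mono₂-≤ {a} {b} {d} {e} a≤b d≤e =
    ≤-trans (+-mono-≤ d a≤b) (≤-resp-≈ (+-comm b d) (+-comm b e) (+-mono-≤ b d≤e))

  ∑ : (n : ℕ) → (Fin n → K) → K
  ∑ = sumF F

  ∑-cong : ∀ n {f g : Fin n → K} → (∀ i → f i ≈ g i) → ∑ n f ≈ ∑ n g
  ∑-cong zero    f≈g = refl
  ∑-cong (suc n) f≈g = +-cong (f≈g fzero) (∑-cong n (λ i → f≈g (fsuc i)))

  ∑-zero : ∀ n → ∑ n (λ _ → 0#) ≈ 0#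
  ∑-zero zero    = refl
  ∑-zero (suc n) = trans (+-cong refl (∑-zero n)) (+-identityˡ 0#)

  ∑-+ : ∀ n (f g : Fin n → K) → ∑ n (λ i → f i + g i) ≈ (∑ n f + ∑ n g)
  ∑-+ zero    f g = sym (+-identityˡ 0#)
  ∑-+ (suc n) f g = trans (+-cong refl (∑-+ n _ _)) (+-interchange _ _ _ _)

  ∑-- : ∀ n (f g : Fin n → K) → ∑ n (λ i → f i - g i) ≈ (∑ n f - ∑ n g)
  ∑-- zero    f g = sym (-‿inverseʳ 0#)
  ∑-- (suc n) f g =
    trans (+-cong refl (∑-- n _ _)) (trans (+-interchange _ _ _ _) (+-cong refl (⁻¹-∙-comm _ _)))

  ∑-*ˡ : ∀ n (a : K) (f : Fin n → K) → ∑ n (λ i → a * f i) ≈ (a * ∑ n f)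
  ∑-*ˡ zero    a f = sym (zeroʳ a)
  ∑-*ˡ (suc n) a f = trans (+-cong refl (∑-*ˡ n a _)) (sym (distribˡ a _ _))

  ∑-*ʳ : ∀ n (f : Fin n → K) (a : K) → ∑ n (λ i → f i * a) ≈ (∑ n f * a)
  ∑-*ʳ n f a = trans (∑-cong n (λ i → *-comm (f i) a)) (trans (∑-*ˡ n a f) (*-comm a _))

  ∑-swap : ∀ n m (f : Fin n → Fin m → K) →
    ∑ n (λ i → ∑ m (λ j → f i j)) ≈ ∑ m (λ j → ∑ n (λ i → f i j))
  ∑-swap zero    m f = sym (∑-zero m)
  ∑-swap (suc n) m f = trans (+-cong refl (∑-swap n m (λ i → f (fsuc i)))) (sym (∑-+ m _ _))

  ∑-mono : ∀ n {f g : Fin n → K} → (∀ i → f i ≤ g i) → ∑ n f ≤ ∑ n g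
  ∑-mono zero    f≤g = ≤-reflexive refl
  ∑-mono (suc n) f≤g = +-mono₂-≤ (f≤g fzero) (∑-mono n (λ i → f≤g (fsuc i)))

  sumExcept-vanishing : ∀ n i (f : Fin n → K) → f i ≈ 0# → sumExcept F n i f ≈ ∑ n f
  sumExcept-vanishing n i f fi≈0 = ∑-cong n dropped
    where
    dropped : ∀ j → (if does (i ≟ j) then 0# else f j) ≈ f j
    dropped j with i ≟ j
    ... | yes ≡-refl = sym fi≈0
    ... | no _       = refl

  -- The field value of a bit; emb F x i is definitionally bit (x i).
  bit : Bool → K
  bit b = if b then 1# else 0#

  -- One coordinate of a cut: λⱼ (sⱼ + uⱼxⱼ − uⱼ) for cut bit l, point bit e,
  -- load s and bound u.
  cutTerm : K → K → K → K → K
  cutTerm l e s u = l * ((s + (u * e)) - u)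

  -- For equal bits the coordinate reproduces e·s (this gives exactness).
  cutTerm-diagonal : ∀ e s u → cutTerm (bit e) (bit e) s u ≈ (bit e * s)
  cutTerm-diagonal false s u = trans (zeroˡ _) (sym (zeroˡ s))
  cutTerm-diagonal true  s u = trans (*-identityˡ _) (trans (cancel s u) (sym (*-identityˡ s)))
    where
    cancel : ∀ s u → ((s + (u * 1#)) - u) ≈ s
    cancel s u = trans (+-cong (+-cong refl (*-identityʳ u)) refl) (//-rightDividesʳ u s)

  -- For a load 0 ≤ s ≤ u every coordinate stays below e·s (this gives validity).
  cutTerm-below : ∀ l e s u → 0# ≤ s → s ≤ u → cutTerm (bit l) (bit e) s u ≤ (bit e * s)
  cutTerm-below false e     s u 0≤s s≤u = ≤-resp-≈ (zeroˡ _) refl (0≤bit* e)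
    where
    0≤bit* : ∀ e → 0# ≤ (bit e * s)
    0≤bit* false = ≤-reflexive (sym (zeroˡ s))
    0≤bit* true  = ≤-resp-≈ refl (*-identityˡ s) 0≤s
  cutTerm-below true  true  s u 0≤s s≤u = ≤-reflexive (cutTerm-diagonal true s u)
  cutTerm-below true  false s u 0≤s s≤u =
    ≤-resp-≈ (trans (*-identityˡ _) (drop s u)) (trans (zeroˡ s) (sym (-‿inverseʳ u)))
      (+-mono-≤ (- u) s≤u)
    where
    drop : ∀ s u → ((s + (u * 0#)) - u) ≈ (s - u)
    drop s u = +-cong (trans (+-cong refl (zeroʳ u)) (+-identityʳ s)) refl

  -- A cut coordinate in the expanded form λs + λue − λu in which it arises
  -- from α⁽λ⁾ and β⁽λ⁾.
  cutTerm-expand : ∀ l e s u → (((l * s) + ((l * u) * e)) - (l * u)) ≈ cutTerm l e s u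
  cutTerm-expand l e s u = begin
    ((l * s) + ((l * u) * e)) - (l * u)    ≈⟨ +-cong refl (-‿distribʳ-* l u) ⟩
    ((l * s) + ((l * u) * e)) + (l * - u)  ≈⟨ +-assoc _ _ _ ⟩
    (l * s) + (((l * u) * e) + (l * - u))  ≈⟨ +-cong refl (+-cong (*-assoc l u e) refl) ⟩
    (l * s) + ((l * (u * e)) + (l * - u))  ≈⟨ +-cong refl (sym (distribˡ l _ _)) ⟩
    (l * s) + (l * ((u * e) - u))          ≈⟨ sym (distribˡ l _ _) ⟩
    l * (s + ((u * e) - u))                ≈⟨ *-cong refl (sym (+-assoc _ _ _)) ⟩
    cutTerm l e s u                        ∎

module BalasMazzolaCuts {c ℓ₁ ℓ₂ : Level} (F : OrderedField c ℓ₁ ℓ₂)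
  (n : ℕ) (B : Fin n → Fin n → OrderedField.Carrier F)
  (B-diag : ∀ i → OrderedField._≈_ F (B i i) (OrderedField.0# F))
  (u : Fin n → OrderedField.Carrier F) where
  open OrderedField F renaming (Carrier to K)
  open OrderedFieldFacts F
  open SetoidReasoning setoid

  load : (Fin n → Bool) → Fin n → K
  load x j = ∑ n (λ i → B j i * emb F x i)

  quad : (Fin n → Bool) → K
  quad x = ∑ n (λ i → ∑ n (λ j → emb F x i * (B i j * emb F x j)))

  cutValue : (Fin n → Bool) → (Fin n → Bool) → K
  cutValue lam x = ∑ n (λ i → alpha F n B u lam i * emb F x i) - beta F n u lam

  quad-by-rows : ∀ x → quad x ≈ ∑ n (λ j → emb F x j * load x j)
  quad-by-rows x = ∑-cong n (λ i → ∑-*ˡ n (emb F x i) _)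

  -- Since bᵢᵢ = 0, the sum over j ≠ i in αᵢ⁽λ⁾ may run over all j.
  alpha-times : ∀ lam x i → (alpha F n B u lam i * emb F x i) ≈
    (∑ n (λ j → (emb F lam j * B j i) * emb F x i) + ((emb F lam i * u i) * emb F x i))
  alpha-times lam x i = begin
    alpha F n B u lam i * emb F x i
      ≈⟨ *-cong (+-cong (sumExcept-vanishing n i _ diagonal-vanishes) refl) refl ⟩
    (∑ n (λ j → emb F lam j * B j i) + (emb F lam i * u i)) * emb F x i
      ≈⟨ distribʳ (emb F x i) _ _ ⟩
    (∑ n (λ j → emb F lam j * B j i) * emb F x i) + ((emb F lam i * u i) * emb F x i)
      ≈⟨ +-cong (sym (∑-*ʳ n _ (emb F x i))) refl ⟩
    ∑ n (λ j → (emb F lam j * B j i) * emb F x i) + ((emb F lam i * u i) * emb F x i) ∎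
    where
    diagonal-vanishes : (emb F lam i * B i i) ≈ 0#
    diagonal-vanishes = trans (*-cong refl (B-diag i)) (zeroʳ _)

  cutValue-by-rows : ∀ lam x → cutValue lam x ≈
    ∑ n (λ j → cutTerm (emb F lam j) (emb F x j) (load x j) (u j))
  cutValue-by-rows lam x = begin
    cutValue lam x
      ≈⟨ +-cong (trans (∑-cong n (alpha-times lam x)) (∑-+ n _ _)) refl ⟩
    (∑ n (λ i → ∑ n (λ j → (l j * B j i) * e i)) + ∑ n (λ j → (l j * u j) * e j)) - β
      ≈⟨ +-cong (+-cong (trans (∑-swap n n _) (∑-cong n lam-load)) refl) refl ⟩
    (∑ n (λ j → l j * load x j) + ∑ n (λ j → (l j * u j) * e j)) - β
      ≈⟨ +-cong (sym (∑-+ n _ _)) refl ⟩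
    ∑ n (λ j → (l j * load x j) + ((l j * u j) * e j)) - β
      ≈⟨ sym (∑-- n _ _) ⟩
    ∑ n (λ j → ((l j * load x j) + ((l j * u j) * e j)) - (l j * u j))
      ≈⟨ ∑-cong n (λ j → cutTerm-expand (l j) (e j) (load x j) (u j)) ⟩
    ∑ n (λ j → cutTerm (l j) (e j) (load x j) (u j)) ∎
    where
    l e : Fin n → K
    l = emb F lam
    e = emb F x
    β : K
    β = beta F n u lam
    lam-load : ∀ j → ∑ n (λ i → (l j * B j i) * e i) ≈ (l j * load x j)
    lam-load j = trans (∑-cong n (λ i → *-assoc (l j) (B j i) (e i))) (∑-*ˡ n (l j) _)

  cut-exact : ∀ lam x → (∀ i → lam i ≡ x i) → cutValue lam x ≈ quad x
  cut-exact lam x lam≡x =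
    trans (cutValue-by-rows lam x) (trans (∑-cong n diagonal) (sym (quad-by-rows x)))
    where
    diagonal : ∀ j → cutTerm (emb F lam j) (emb F x j) (load x j) (u j) ≈ (emb F x j * load x j)
    diagonal j rewrite lam≡x j = cutTerm-diagonal (x j) (load x j) (u j)

  cut-valid : ∀ lam x → (∀ j → 0# ≤ load x j) → (∀ j → load x j ≤ u j) →
    cutValue lam x ≤ quad x
  cut-valid lam x 0≤load load≤u = ≤-resp-≈ (cutValue-by-rows lam x) (quad-by-rows x)
    (∑-mono n (λ j → cutTerm-below (lam j) (x j) (load x j) (u j) (0≤load j) (load≤u j)))

  load-nonneg : (∀ i j → 0# ≤ B i j) → ∀ x j → 0# ≤ load x j
  load-nonneg B-nonneg x j = ≤-resp-≈ (sym (∑-zero n)) refl (∑-mono n term-nonneg)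
    where
    term-nonneg : ∀ i → 0# ≤ (B j i * emb F x i)
    term-nonneg i with x i
    ... | true  = ≤-resp-≈ refl (*-identityʳ _) (B-nonneg j i)
    ... | false = ≤-reflexive (sym (zeroʳ _))

  load-bounded : (X̄ : (Fin n → K) → Set ℓ₂) → IsMaxU F n B X̄ u →
    ∀ x → X̄ (emb F x) → ∀ j → load x j ≤ u j
  load-bounded X̄ u-max x x∈X̄ j =
    ≤-resp-≈ (sym (sumExcept-vanishing n j _ diagonal-vanishes)) refl (proj₁ (u-max j) (emb F x) x∈X̄)
    where
    diagonal-vanishes : (B j j * emb F x j) ≈ 0#
    diagonal-vanishes = trans (*-cong (B-diag j) refl) (zeroˡ _)

  master-optimal⇒optimal : (cv : Fin n → K) (X : (Fin n → Bool) → Set ℓ₂) →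
    (∀ lam y → X y → cutValue lam y ≤ quad y) →
    (lams : ℕ → Fin n → Bool) (s t : ℕ) → 1 Data.Nat.≤ t → t Data.Nat.≤ s →
    (x̃ : Fin n → Bool) → (∀ i → lams t i ≡ x̃ i) →
    OptimalSolDL F n B cv u X lams s x̃ → OptimalP F n B cv X x̃
  master-optimal⇒optimal cv X valid lams s t 1≤t t≤s x̃ cut-at-x̃ (z , (x̃∈X , cuts) , optimal) =
    x̃∈X , λ y y∈X → ≤-trans (+-mono-≤ (linear x̃) quad-below-z) (optimal (quad y) y (lift y y∈X))
    where
    linear : (Fin n → Bool) → K
    linear x = ∑ n (λ i → cv i * emb F x i)
    -- the cut generated by x̃ forces z ≥ x̃ᵀBx̃
    quad-below-z : quad x̃ ≤ z
    quad-below-z = ≤-resp-≈ (sym (cut-exact (lams t) x̃ cut-at-x̃)) refl (cuts t 1≤t t≤s)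
    -- every y ∈ X, paired with z = yᵀBy, is feasible for (DL₁ˢ)
    lift : ∀ y → X y → FeasibleDL F n B u X lams s (quad y) y
    lift y y∈X = y∈X , λ t′ _ _ → valid (lams t′) y y∈X

open OrderedField using (Carrier; 0#; 1#) renaming (_≤_ to le; _≈_ to eq)

-- The cut λ⁽ʳ⁺¹⁾ = x̃ belongs to (DL₁ˢ) for every s > r, and all cuts are valid
-- on X ⊆ X̄, so optimality of x̃ for (DL₁ˢ) makes it optimal for (P).
lemma2 : {c ℓ₁ ℓ₂ : Level} (F : OrderedField c ℓ₁ ℓ₂) →
    (n : ℕ) → 1 Data.Nat.≤ n →
    (B : Fin n → Fin n → Carrier F) →
    (∀ i j → le F (0# F) (B i j)) → (∀ i → eq F (B i i) (0# F)) →
    (cv : Fin n → Carrier F) →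
    (X : (Fin n → Bool) → Set ℓ₂) →
    (X̄ : (Fin n → Carrier F) → Set ℓ₂) →
    (∀ x → X x → X̄ (emb F x)) →
    (∀ x → X̄ x → ∀ i → le F (0# F) (x i) × le F (x i) (1# F)) →
    (u : Fin n → Carrier F) → IsMaxU F n B X̄ u →
    (lams : ℕ → Fin n → Bool) →
    (r : ℕ) → 1 Data.Nat.≤ r →
    (x̃ : Fin n → Bool) →
    OptimalSolDL F n B cv u X lams r x̃ →
    (∀ i → lams (ℕ.suc r) i ≡ x̃ i) →
    (s : ℕ) → r < s →
    OptimalSolDL F n B cv u X lams s x̃ →
    OptimalP F n B cv X x̃
lemma2 F n _ B B-nonneg B-diag cv X X̄ X⊆X̄ _ u u-max lams r _ x̃ _ cut-at-x̃ s r<s =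
  master-optimal⇒optimal cv X cuts-valid lams s (suc r) (s≤s z≤n) r<s x̃ cut-at-x̃
  where
  open BalasMazzolaCuts F n B B-diag u
  cuts-valid : ∀ lam y → X y → le F (cutValue lam y) (quad y)
  cuts-valid lam y y∈X = cut-valid lam y (load-nonneg B-nonneg y)
    (load-bounded X̄ u-max y (X⊆X̄ y y∈X))
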